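{- Let $k\ge 1$ and let $G$ be a $k$-path with at least $k+2$ vertices, and let $v$ be a vertex of $G$ of degree $k$. Then $G-v$ is also a $k$-path.
   Context: $k$-trees are defined recursively: the complete graph $K_{k+1}$ is a $k$-tree; and a $k$-tree on $n+1$ vertices ($n\ge k+1$) is obtained from a $k$-tree $H$ on $n$ vertices by adding a new vertex adjacent to all vertices of some $k$-clique of $H$. A $k$-path is a $k$-tree that is either $K_{k+1}$ or has exactly two vertices of degree $k$. $G-v$ denotes the graph obtained by deleting $v$ and its incident edges. -}

module Defs where

open import Data.Nat using (ℕ; zero; suc; _+_; _≟_)
open import Data.Fin using (Fin; punchIn)
open import Data.Bool using (Bool; true; false; if_then_else_)
open import Data.List using (List; length; filter; map; allFin)
open import Data.Nat.ListAction using (sum)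
open import Relation.Binary.PropositionalEquality using (_≡_; _≢_)
open import Data.Product using (_×_)
open import Data.Sum using (_⊎_)

record Graph (n : ℕ) : Set where
  field
    adj    : Fin n → Fin n → Bool
    sym    : ∀ u w → adj u w ≡ adj w u
    irrefl : ∀ u → adj u u ≡ false
open Graph public

deg : ∀ {n} → Graph n → Fin n → ℕ
deg {n} G v = sum (map (λ u → if adj G v u then 1 else 0) (allFin n))

del : ∀ {n} → Graph (suc n) → Fin (suc n) → Graph n
del G v = record
  { adj    = λ u w → adj G (punchIn v u) (punchIn v w)
  ; sym    = λ u w → sym G (punchIn v u) (punchIn v w)
  ; irrefl = λ u → irrefl G (punchIn v u)
  }

Complete : ∀ {n} → Graph n → Set
Complete G = ∀ u w → u ≢ w → adj G u w ≡ true

NbhdIsKClique : ∀ {n} → ℕ → Graph n → Fin n → Set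
NbhdIsKClique k G v =
  deg G v ≡ k ×
  (∀ u w → adj G v u ≡ true → adj G v w ≡ true → u ≢ w → adj G u w ≡ true)

-- k-trees (recursive definition; vertex labels are irrelevant: G arises
-- from the k-tree G - v by adding v adjacent to a k-clique)
data KTree (k : ℕ) : ∀ {n} → Graph n → Set where
  base : (G : Graph (suc k)) → Complete G → KTree k G
  step : ∀ {n} (G : Graph (suc n)) (v : Fin (suc n)) →
         KTree k (del G v) → NbhdIsKClique k G v → KTree k G

numDeg : ∀ {n} → ℕ → Graph n → ℕ
numDeg {n} k G = length (filter (λ u → deg G u ≟ k) (allFin n))

KPath : (k : ℕ) → ∀ {n} → Graph n → Set
KPath k {n} G = KTree k G × ((n ≡ suc k × Complete G) ⊎ numDeg k G ≡ 2)

module Submission where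

-- A degree-k vertex u of a k-tree T on at least k + 2 vertices can be deleted: if T
-- was built by attaching a vertex x to the k-tree T − x, then u ≠ x is not adjacent
-- to x (otherwise u would have degree k − 1 in T − x), so deleting u commutes with
-- attaching x and induction applies.  The same induction shows that such a k-tree has
-- two degree-k vertices, and that its degree-k vertices are pairwise nonadjacent.
-- Hence G − v has at least two degree-k vertices, and at most two: among them at most
-- one is adjacent to v, since the neighbourhood of v is a clique, and the others
-- already have degree k in G, where v is one of only two such vertices.

open import Defs renaming (sym to adj-sym)
open import Data.Bool using (Bool; true; false; if_then_else_; _∧_; not)
open import Data.Bool.Properties using (not-¬)
open import Data.Empty using (⊥-elim)
open import Data.Fin using (Fin; zero; suc; punchIn; punchOut)
open import Data.Fin.Properties using (punchIn-punchOut; punchInᵢ≢i; punchIn-injective)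
  renaming (suc-injective to suc-injectiveᶠ; _≟_ to _≟ᶠ_)
open import Data.List using (map; tabulate; filter; length)
open import Data.Nat using (ℕ; zero; suc; _+_; _≤_; _<_; z≤n; s≤s; _≟_)
open import Data.Nat.ListAction using (sum)
open import Data.Nat.Properties
  using (+-0-commutativeMonoid; +-comm; +-mono-≤; suc-injective; 1+n≰n; ≤-refl; ≤-reflexive; ≤-trans;
         ≤-antisym; ≤-pred; m≤n⇒m≤1+n; m≤n+m; m≤n⇒m<n∨m≡n)
open import Algebra.Properties.CommutativeMonoid.Sum +-0-commutativeMonoid
  using (sum-remove; sum-cong-≗; ∑-distrib-+) renaming (sum to ∑)
open import Data.Product using (_×_; _,_; proj₁; ∃-syntax; ∃₂)
open import Data.Sum using (inj₁; inj₂)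
open import Function using (_∘_)
open import Level using (0ℓ)
open import Relation.Nullary using (Dec; yes; no; does)
open import Relation.Nullary.Decidable using (dec-true)
open import Relation.Unary using (Pred; Decidable)
open import Relation.Binary.PropositionalEquality using (_≡_; _≢_; refl; sym; trans; cong; cong₂; subst)
open Relation.Binary.PropositionalEquality.≡-Reasoning

data PunchInView {n} (v : Fin (suc n)) : Fin (suc n) → Set where
  hit     : PunchInView v v
  punched : ∀ w → PunchInView v (punchIn v w)

punchInView : ∀ {n} (v u : Fin (suc n)) → PunchInView v u
punchInView v u with v ≟ᶠ u
... | yes refl = hit
... | no v≢u   = subst (PunchInView v) (punchIn-punchOut v≢u) (punched (punchOut v≢u))

indicator : Bool → ℕ
indicator b = if b then 1 else 0

count : ∀ {n} → (Fin n → Bool) → ℕ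
count b = ∑ (indicator ∘ b)

count-remove : ∀ {n} (b : Fin (suc n) → Bool) i → count b ≡ indicator (b i) + count (b ∘ punchIn i)
count-remove b i = sum-remove (indicator ∘ b)

count-cong : ∀ {n} {b c : Fin n → Bool} → (∀ i → b i ≡ c i) → count b ≡ count c
count-cong b≗c = sum-cong-≗ (cong indicator ∘ b≗c)

count-split : ∀ {n} (b c : Fin n → Bool) →
              count b ≡ count (λ i → b i ∧ c i) + count (λ i → b i ∧ not (c i))
count-split {n} b c = trans (sum-cong-≗ split) (∑-distrib-+ {n} _ _)
  where
  split : ∀ i → indicator (b i) ≡ indicator (b i ∧ c i) + indicator (b i ∧ not (c i))
  split i with b i | c i
  ... | false | _     = refl
  ... | true  | false = refl
  ... | true  | true  = refl

count-mono : ∀ {n} (b c : Fin n → Bool) → (∀ i → b i ≡ true → c i ≡ true) → count b ≤ count c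
count-mono {zero}  b c b⊆c = z≤n
count-mono {suc n} b c b⊆c with b zero in b₀ | c zero in c₀
... | false | false = count-mono (b ∘ suc) (c ∘ suc) (b⊆c ∘ suc)
... | false | true  = m≤n⇒m≤1+n (count-mono (b ∘ suc) (c ∘ suc) (b⊆c ∘ suc))
... | true  | true  = s≤s (count-mono (b ∘ suc) (c ∘ suc) (b⊆c ∘ suc))
... | true  | false with () ← trans (sym (b⊆c zero b₀)) c₀

count≤n : ∀ {n} (b : Fin n → Bool) → count b ≤ n
count≤n {zero}  b = z≤n
count≤n {suc n} b with b zero
... | true  = s≤s (count≤n (b ∘ suc))
... | false = m≤n⇒m≤1+n (count≤n (b ∘ suc))

count-true : ∀ {n} (b : Fin n → Bool) → (∀ i → b i ≡ true) → count b ≡ n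
count-true {zero}  b all = refl
count-true {suc n} b all rewrite all zero = cong suc (count-true (b ∘ suc) (all ∘ suc))

count≡0 : ∀ {n} (b : Fin n → Bool) → (∀ i → b i ≡ false) → count b ≡ 0
count≡0 {zero}  b none = refl
count≡0 {suc n} b none rewrite none zero = count≡0 (b ∘ suc) (none ∘ suc)

count≡n⇒true : ∀ {n} (b : Fin n → Bool) → count b ≡ n → ∀ i → b i ≡ true
count≡n⇒true {suc n} b full i with b zero in b₀
count≡n⇒true {suc n} b full zero    | true  = b₀
count≡n⇒true {suc n} b full (suc i) | true  = count≡n⇒true (b ∘ suc) (suc-injective full) i
count≡n⇒true {suc n} b full i       | false = ⊥-elim (1+n≰n (subst (_≤ n) full (count≤n (b ∘ suc))))

count<n⇒false : ∀ {n} (b : Fin n → Bool) → count b < n → ∃[ i ] b i ≡ false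
count<n⇒false {suc n} b partial with b zero in b₀
... | false = zero , b₀
... | true  with i , bᵢ ← count<n⇒false (b ∘ suc) (≤-pred partial) = suc i , bᵢ

1≤count : ∀ {n} (b : Fin n → Bool) {i} → b i ≡ true → 1 ≤ count b
1≤count {suc n} b {i} bᵢ rewrite count-remove b i | bᵢ = s≤s z≤n

2≤count : ∀ {n} (b : Fin n → Bool) {i j} → i ≢ j → b i ≡ true → b j ≡ true → 2 ≤ count b
2≤count {suc n} b {i} {j} i≢j bᵢ bⱼ with punchInView i j
... | hit        = ⊥-elim (i≢j refl)
... | punched j′ rewrite count-remove b i | bᵢ = s≤s (1≤count (b ∘ punchIn i) bⱼ)

count≤1 : ∀ {n} (b : Fin n → Bool) → (∀ i j → b i ≡ true → b j ≡ true → i ≡ j) → count b ≤ 1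
count≤1 {zero}  b unique = z≤n
count≤1 {suc n} b unique with b zero in b₀
... | false = count≤1 (b ∘ suc) (λ i j bᵢ bⱼ → suc-injectiveᶠ (unique (suc i) (suc j) bᵢ bⱼ))
... | true  = s≤s (≤-reflexive (count≡0 (b ∘ suc) others))
  where
  others : ∀ i → b (suc i) ≡ false
  others i with b (suc i) in bᵢ
  ... | false = refl
  ... | true  with () ← unique zero (suc i) b₀ bᵢ

dec-true⁻¹ : ∀ {P : Set} (P? : Dec P) → does P? ≡ true → P
dec-true⁻¹ (yes p) _  = p
dec-true⁻¹ (no _)  ()

-- Deleting v and then w is deleting u = punchIn v w and then v, now at position punchOut u≢v.
punchIn-punchIn : ∀ {n} (v : Fin (suc (suc n))) w (u≢v : punchIn v w ≢ v) x →
                  punchIn v (punchIn w x) ≡ punchIn (punchIn v w) (punchIn (punchOut u≢v) x)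
punchIn-punchIn zero    w       u≢v x = refl
punchIn-punchIn (suc v) zero    u≢v x = refl
punchIn-punchIn {suc n} (suc v) (suc w) u≢v zero    = refl
punchIn-punchIn {suc n} (suc v) (suc w) u≢v (suc x) = cong suc (punchIn-punchIn v w (u≢v ∘ cong suc) x)

sum-map-tabulate : ∀ {n} {A : Set} (f : A → ℕ) (g : Fin n → A) → sum (map f (tabulate g)) ≡ ∑ (f ∘ g)
sum-map-tabulate {zero}  f g = refl
sum-map-tabulate {suc n} f g = cong (f (g zero) +_) (sum-map-tabulate f (g ∘ suc))

length-filter-tabulate : ∀ {n} {A : Set} {P : Pred A 0ℓ} (P? : Decidable P) (g : Fin n → A) →
                         length (filter P? (tabulate g)) ≡ count (does ∘ P? ∘ g)
length-filter-tabulate {zero}  P? g = refl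
length-filter-tabulate {suc n} P? g with does (P? (g zero))
... | true  = cong suc (length-filter-tabulate P? (g ∘ suc))
... | false = length-filter-tabulate P? (g ∘ suc)

deg≡count : ∀ {n} (G : Graph n) u → deg G u ≡ count (adj G u)
deg≡count G u = sum-map-tabulate (indicator ∘ adj G u) (λ i → i)

numDeg≡count : ∀ {n} k (G : Graph n) → numDeg k G ≡ count (λ u → does (deg G u ≟ k))
numDeg≡count k G = length-filter-tabulate (λ u → deg G u ≟ k) (λ i → i)

deg≡count-punchIn : ∀ {n} (G : Graph (suc n)) v → deg G v ≡ count (adj G v ∘ punchIn v)
deg≡count-punchIn G v = begin
  deg G v                                              ≡⟨ deg≡count G v ⟩
  count (adj G v)                                      ≡⟨ count-remove (adj G v) v ⟩
  indicator (adj G v v) + count (adj G v ∘ punchIn v)  ≡⟨ cong (λ b → indicator b + count (adj G v ∘ punchIn v)) (irrefl G v) ⟩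
  count (adj G v ∘ punchIn v)                          ∎

deg-punchIn : ∀ {n} (G : Graph (suc n)) v w →
              deg G (punchIn v w) ≡ indicator (adj G (punchIn v w) v) + deg (del G v) w
deg-punchIn G v w = begin
  deg G u                                          ≡⟨ deg≡count G u ⟩
  count (adj G u)                                  ≡⟨ count-remove (adj G u) v ⟩
  indicator (adj G u v) + count (adj (del G v) w)  ≡⟨ cong (indicator (adj G u v) +_) (deg≡count (del G v) w) ⟨
  indicator (adj G u v) + deg (del G v) w          ∎
  where u = punchIn v w

deg-punchIn-nonadj : ∀ {n} (G : Graph (suc n)) v w → adj G (punchIn v w) v ≡ false →
                     deg G (punchIn v w) ≡ deg (del G v) w
deg-punchIn-nonadj G v w u≁v = trans (deg-punchIn G v w) (cong (λ b → indicator b + deg (del G v) w) u≁v)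

deg-cong : ∀ {n} {G H : Graph n} v → (∀ u → adj G v u ≡ adj H v u) → deg G v ≡ deg H v
deg-cong {G = G} {H} v G≗H = trans (deg≡count G v) (trans (count-cong G≗H) (sym (deg≡count H v)))

deg-complete : ∀ {m} (H : Graph (suc m)) → Complete H → ∀ u → deg H u ≡ m
deg-complete H complete u = trans (deg≡count-punchIn H u)
  (count-true _ (λ i → complete u (punchIn u i) (punchInᵢ≢i u i ∘ sym)))

adjacent-to-all-but : ∀ {k} (G : Graph (suc (suc k))) {v} w → deg G v ≡ k → adj G (punchIn v w) v ≡ false →
                      ∀ a → a ≢ v → a ≢ punchIn v w → adj G v a ≡ true
adjacent-to-all-but {k} G {v} w dv u≁v a a≢v a≢u with punchInView v a
... | hit        = ⊥-elim (a≢v refl)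
... | punched a′ with punchInView w a′
...   | hit       = ⊥-elim (a≢u refl)
...   | punched z = count≡n⇒true (adj G v ∘ punchIn v ∘ punchIn w) count-rest z
  where
  count-rest : count (adj G v ∘ punchIn v ∘ punchIn w) ≡ k
  count-rest = begin
    count (adj G v ∘ punchIn v ∘ punchIn w)
      ≡⟨ cong (λ b → indicator b + count (adj G v ∘ punchIn v ∘ punchIn w)) (trans (adj-sym G v _) u≁v) ⟨
    indicator (adj G v (punchIn v w)) + count (adj G v ∘ punchIn v ∘ punchIn w)
      ≡⟨ count-remove (adj G v ∘ punchIn v) w ⟨
    count (adj G v ∘ punchIn v)
      ≡⟨ deg≡count-punchIn G v ⟨
    deg G v
      ≡⟨ dv ⟩
    k ∎

Complete-del-exchange : ∀ {k} (G : Graph (suc (suc k))) {v} w → Complete (del G v) → deg G v ≡ k →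
                        adj G (punchIn v w) v ≡ false → Complete (del G (punchIn v w))
Complete-del-exchange G {v} w complete dv u≁v x y x≢y =
  complete-off-u (punchIn u x) (punchIn u y) (punchInᵢ≢i u x) (punchInᵢ≢i u y) (x≢y ∘ punchIn-injective u x y)
  where
  u = punchIn v w
  v∼ : ∀ a → a ≢ v → a ≢ u → adj G v a ≡ true
  v∼ = adjacent-to-all-but G w dv u≁v
  complete-off-u : ∀ a b → a ≢ u → b ≢ u → a ≢ b → adj G a b ≡ true
  complete-off-u a b a≢u b≢u a≢b with punchInView v a | punchInView v b
  ... | hit        | _          = v∼ b (a≢b ∘ sym) b≢u
  ... | punched a′ | hit        = trans (adj-sym G a v) (v∼ a a≢b a≢u)
  ... | punched a′ | punched b′ = complete a′ b′ (a≢b ∘ cong (punchIn v))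

KTree-cong : ∀ {k m} {G H : Graph m} → (∀ x y → adj G x y ≡ adj H x y) → KTree k G → KTree k H
KTree-cong G≗H (base G complete) = base _ (λ x y x≢y → trans (sym (G≗H x y)) (complete x y x≢y))
KTree-cong {H = H} G≗H (step G v t (dv , clique)) =
  step H v (KTree-cong (λ x y → G≗H (punchIn v x) (punchIn v y)) t)
    ( trans (sym (deg-cong {G = G} {H} v (G≗H v))) dv
    , λ x y vx vy x≢y → trans (sym (G≗H x y)) (clique x y (trans (G≗H v x) vx) (trans (G≗H v y) vy) x≢y))

KTree-k<order : ∀ {k m} {G : Graph m} → KTree k G → k < m
KTree-k<order (base G _)     = ≤-refl
KTree-k<order (step G v t _) = m≤n⇒m≤1+n (KTree-k<order t)

KTree-complete : ∀ {k m} {G : Graph m} → KTree k G → m ≡ suc k → Complete G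
KTree-complete (base G complete) _    = complete
KTree-complete (step G v t _)    refl = ⊥-elim (1+n≰n (KTree-k<order t))

KTree-k≤deg : ∀ {k m} {G : Graph m} → KTree k G → ∀ u → k ≤ deg G u
KTree-k≤deg (base G complete) u = ≤-reflexive (sym (deg-complete G complete u))
KTree-k≤deg {k} (step G v t (dv , _)) u with punchInView v u
... | hit       = ≤-reflexive (sym dv)
... | punched w = subst (k ≤_) (sym (deg-punchIn G v w)) (≤-trans (KTree-k≤deg t w) (m≤n+m _ _))

KTree-punchIn-degK : ∀ {k n} (G : Graph (suc n)) v → KTree k (del G v) → ∀ w → deg G (punchIn v w) ≡ k →
                     adj G (punchIn v w) v ≡ false × deg (del G v) w ≡ k
KTree-punchIn-degK G v t w du with adj G (punchIn v w) v in u∼v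
... | false = refl , trans (sym (deg-punchIn-nonadj G v w u∼v)) du
... | true  = ⊥-elim (1+n≰n (subst (_≤ deg (del G v) w) (sym 1+deg≡k) (KTree-k≤deg t w)))
  where
  1+deg≡k : suc (deg (del G v) w) ≡ _
  1+deg≡k = begin
    suc (deg (del G v) w)                                      ≡⟨ cong (λ b → indicator b + deg (del G v) w) u∼v ⟨
    indicator (adj G (punchIn v w) v) + deg (del G v) w        ≡⟨ deg-punchIn G v w ⟨
    deg G (punchIn v w)                                        ≡⟨ du ⟩
    _                                                          ∎

KTree-simplicial : ∀ {k m} {G : Graph m} → KTree k G → ∀ {u} → deg G u ≡ k →
                   ∀ x y → adj G u x ≡ true → adj G u y ≡ true → x ≢ y → adj G x y ≡ true
KTree-simplicial (base G complete) _ x y _ _ x≢y = complete x y x≢y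
KTree-simplicial (step G v t (_ , clique)) {u} du x y ux uy x≢y with punchInView v u
... | hit = clique x y ux uy x≢y
... | punched w with u≁v , dw ← KTree-punchIn-degK G v t w du with punchInView v x | punchInView v y
...   | hit        | _          = ⊥-elim (not-¬ ux u≁v)
...   | punched _  | hit        = ⊥-elim (not-¬ uy u≁v)
...   | punched x′ | punched y′ = KTree-simplicial t dw x′ y′ ux uy (x≢y ∘ cong (punchIn v))

KTree-degK-nonadjacent : ∀ {k n} {G : Graph (suc n)} → KTree k G → suc k ≤ n →
                         ∀ {x y} → deg G x ≡ k → deg G y ≡ k → adj G x y ≢ true
KTree-degK-nonadjacent (base G _) k<k = ⊥-elim (1+n≰n k<k)
KTree-degK-nonadjacent (step G v t (dv , _)) (s≤s k≤n) {x} {y} dx dy x∼y with punchInView v x | punchInView v y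
... | hit | hit = not-¬ x∼y (irrefl G v)
... | hit | punched y′ = not-¬ (trans (adj-sym G _ v) x∼y) (proj₁ (KTree-punchIn-degK G v t y′ dy))
... | punched x′ | hit = not-¬ x∼y (proj₁ (KTree-punchIn-degK G v t x′ dx))
... | punched x′ | punched y′
  with x≁v , dx′ ← KTree-punchIn-degK G v t x′ dx | y≁v , dy′ ← KTree-punchIn-degK G v t y′ dy
  with m≤n⇒m<n∨m≡n k≤n
...   | inj₁ k<n  = KTree-degK-nonadjacent t k<n dx′ dy′ x∼y
...   | inj₂ refl = not-¬ (trans (adj-sym G _ v) v∼y) y≁v
  where
  y≢x : punchIn v y′ ≢ punchIn v x′
  y≢x y≡x = not-¬ (subst (λ a → adj G (punchIn v x′) a ≡ true) y≡x x∼y) (irrefl G _)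
  v∼y : adj G v (punchIn v y′) ≡ true
  v∼y = adjacent-to-all-but G x′ dv x≁v (punchIn v y′) (punchInᵢ≢i v y′) y≢x

KTree-del : ∀ {k n} {G : Graph (suc n)} → KTree k G → suc k ≤ n → ∀ {u} → deg G u ≡ k → KTree k (del G u)
KTree-del (base G _) k<k = ⊥-elim (1+n≰n k<k)
KTree-del {k} (step G v t (dv , clique)) (s≤s k≤n) {u} du with punchInView v u
... | hit = t
... | punched w with u≁v , dw ← KTree-punchIn-degK G v t w du with m≤n⇒m<n∨m≡n k≤n
...   | inj₂ refl = base _ (Complete-del-exchange G w (KTree-complete t refl) dv u≁v)
...   | inj₁ k<n  =
  step (del G u′) v′ (KTree-cong exchange (KTree-del t k<n dw)) (dv′ , clique′)
  where
  u′ = punchIn v w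
  u≢v : u′ ≢ v
  u≢v = punchInᵢ≢i v w
  v′ = punchOut u≢v
  v′↦v : punchIn u′ v′ ≡ v
  v′↦v = punchIn-punchOut u≢v
  exchange : ∀ x y → adj (del (del G v) w) x y ≡ adj (del (del G u′) v′) x y
  exchange x y = cong₂ (adj G) (punchIn-punchIn v w u≢v x) (punchIn-punchIn v w u≢v y)
  dv′ : deg (del G u′) v′ ≡ k
  dv′ = begin
    deg (del G u′) v′     ≡⟨ deg-punchIn-nonadj G u′ v′ (trans (cong (λ a → adj G a u′) v′↦v) (trans (adj-sym G v u′) u≁v)) ⟨
    deg G (punchIn u′ v′) ≡⟨ cong (deg G) v′↦v ⟩
    deg G v               ≡⟨ dv ⟩
    k                     ∎
  clique′ : ∀ x y → adj (del G u′) v′ x ≡ true → adj (del G u′) v′ y ≡ true → x ≢ y → adj (del G u′) x y ≡ true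
  clique′ x y v∼x v∼y x≢y = clique (punchIn u′ x) (punchIn u′ y)
    (subst (λ a → adj G a (punchIn u′ x) ≡ true) v′↦v v∼x)
    (subst (λ a → adj G a (punchIn u′ y) ≡ true) v′↦v v∼y)
    (x≢y ∘ punchIn-injective u′ x y)

TwoVerticesOfDegree : ℕ → ∀ {n} → Graph n → Set
TwoVerticesOfDegree k {n} G = ∃₂ λ (x y : Fin n) → x ≢ y × deg G x ≡ k × deg G y ≡ k

pair-with-new-vertex : ∀ {k n} (G : Graph (suc n)) {v} → deg G v ≡ k →
                       ∀ z → deg (del G v) z ≡ k → adj G v (punchIn v z) ≡ false → TwoVerticesOfDegree k G
pair-with-new-vertex G {v} dv z dz v≁z =
  v , punchIn v z , punchInᵢ≢i v z ∘ sym , dv , trans (deg-punchIn-nonadj G v z (trans (adj-sym G _ v) v≁z)) dz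

KTree-two-degK : ∀ {k n} {G : Graph (suc n)} → KTree k G → suc k ≤ n → TwoVerticesOfDegree k G
KTree-two-degK (base G _) k<k = ⊥-elim (1+n≰n k<k)
KTree-two-degK {k} (step G v t (dv , clique)) (s≤s k≤n) with m≤n⇒m<n∨m≡n k≤n
... | inj₂ refl
  with z , v≁z ← count<n⇒false (adj G v ∘ punchIn v) (≤-reflexive (cong suc (trans (sym (deg≡count-punchIn G v)) dv)))
  = pair-with-new-vertex G dv z (deg-complete (del G v) (KTree-complete t refl) z) v≁z
... | inj₁ k<n with x , y , x≢y , dx , dy ← KTree-two-degK t k<n
                  with adj G v (punchIn v x) in v∼x | adj G v (punchIn v y) in v∼y
...   | false | _     = pair-with-new-vertex G dv x dx v∼x
...   | true  | false = pair-with-new-vertex G dv y dy v∼y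
...   | true  | true  = ⊥-elim (KTree-degK-nonadjacent t k<n dx dy
                          (clique (punchIn v x) (punchIn v y) v∼x v∼y (x≢y ∘ punchIn-injective v x y)))

numDeg-del : ∀ {k n} {G : Graph (suc (suc n))} → KTree k G → suc k ≤ n →
             ∀ {v} → deg G v ≡ k → numDeg k G ≡ 2 → numDeg k (del G v) ≡ 2
numDeg-del {k} {n} {G} t k<n {v} dv two-in-G = ≤-antisym at-most-two at-least-two
  where
  H = del G v
  t′ = KTree-del t (m≤n⇒m≤1+n k<n) dv
  isDegK : ∀ {m} → Graph m → Fin m → Bool
  isDegK Γ u = does (deg Γ u ≟ k)
  v∼ : Fin (suc n) → Bool
  v∼ w = adj G v (punchIn v w)

  at-least-two : 2 ≤ numDeg k H
  at-least-two with x , y , x≢y , dx , dy ← KTree-two-degK t′ k<n =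
    subst (2 ≤_) (sym (numDeg≡count k H)) (2≤count (isDegK H) x≢y (dec-true (_ ≟ k) dx) (dec-true (_ ≟ k) dy))

  at-most-one-neighbour : count (λ w → isDegK H w ∧ v∼ w) ≤ 1
  at-most-one-neighbour = count≤1 _ unique
    where
    unique : ∀ x y → isDegK H x ∧ v∼ x ≡ true → isDegK H y ∧ v∼ y ≡ true → x ≡ y
    unique x y bx by with isDegK H x in dx | v∼ x in v∼x | isDegK H y in dy | v∼ y in v∼y | x ≟ᶠ y
    ... | true | true | true | true | yes x≡y = x≡y
    ... | true | true | true | true | no x≢y  = ⊥-elim (KTree-degK-nonadjacent t′ k<n
          (dec-true⁻¹ (_ ≟ k) dx) (dec-true⁻¹ (_ ≟ k) dy)
          (KTree-simplicial t dv _ _ v∼x v∼y (x≢y ∘ punchIn-injective v x y)))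

  degK-in-G : ∀ w → isDegK H w ∧ not (v∼ w) ≡ true → isDegK G (punchIn v w) ≡ true
  degK-in-G w b with isDegK H w in dw | v∼ w in v∼w
  ... | true | false = dec-true (_ ≟ k)
        (trans (deg-punchIn-nonadj G v w (trans (adj-sym G _ v) v∼w)) (dec-true⁻¹ (_ ≟ k) dw))

  others-in-G : count (isDegK G ∘ punchIn v) ≡ 1
  others-in-G = suc-injective (begin
    suc (count (isDegK G ∘ punchIn v))                    ≡⟨ cong (λ b → indicator b + count (isDegK G ∘ punchIn v)) (dec-true (_ ≟ k) dv) ⟨
    indicator (isDegK G v) + count (isDegK G ∘ punchIn v) ≡⟨ count-remove (isDegK G) v ⟨
    count (isDegK G)                                      ≡⟨ numDeg≡count k G ⟨
    numDeg k G                                            ≡⟨ two-in-G ⟩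
    2                                                     ∎)

  at-most-one-other : count (λ w → isDegK H w ∧ not (v∼ w)) ≤ 1
  at-most-one-other = ≤-trans (count-mono _ _ degK-in-G) (≤-reflexive others-in-G)

  at-most-two : numDeg k H ≤ 2
  at-most-two = ≤-trans (≤-reflexive (trans (numDeg≡count k H) (count-split (isDegK H) v∼)))
                        (+-mono-≤ at-most-one-neighbour at-most-one-other)

lemma3p1 : (k : ℕ) → 1 ≤ k → (n : ℕ) → (G : Graph (suc n)) →
           KPath k G → k + 2 ≤ suc n →
           (v : Fin (suc n)) → deg G v ≡ k →
           KPath k (del G v)
lemma3p1 k _ n G (t , shape) k+2≤order v dv with ≤-pred (subst (_≤ suc n) (+-comm k 2) k+2≤order)
lemma3p1 k _ n G (t , inj₁ (refl , _)) _ v dv | k<k = ⊥-elim (1+n≰n k<k)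
lemma3p1 k _ n G (t , inj₂ two)        _ v dv | k<n with m≤n⇒m<n∨m≡n k<n
... | inj₂ refl       = t′ , inj₁ (refl , KTree-complete t′ refl)
  where t′ = KTree-del t k<n dv
... | inj₁ (s≤s k<n′) = KTree-del t k<n dv , inj₂ (numDeg-del t k<n′ dv two)
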